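{- Let $n \geq 5$ be an integer and define the graph $G'_n$ as follows. If $n$ is odd, let $m = \frac{n-1}{2}$ and let $G'_n$ consist of vertices $a_0, \ldots, a_m, b_0, \ldots, b_{m-1}$, where for each $0 \le i < m$ the vertices $a_i, b_i, a_{i+1}$ form a triangle (a chain of $m$ triangles, each consecutive pair sharing one vertex). If $n$ is even, let $m = \frac{n-4}{2}$, take the chain of $m$ triangles on vertices $a_0, \ldots, a_m, b_0, \ldots, b_{m-1}$ as before, and add three new vertices which together with $a_m$ induce a complete graph $K_4$. Then \[\overrightarrow{\mathrm{diam}}(G'_n) = \begin{cases} \left\lfloor \frac{3n}{4} \right\rfloor & \text{if } n \text{ is even},\\ \left\lfloor \frac{3(n+1)}{4} \right\rfloor & \text{if } n \text{ is odd}.\end{cases}\]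
   Context: An orientation of a graph assigns a direction to each edge; it is strong if the resulting digraph is strongly connected. The diameter of a strong digraph is the maximum over ordered pairs $(u,v)$ of the directed distance from $u$ to $v$. The oriented diameter $\overrightarrow{\mathrm{diam}}(G)$ of a bridgeless graph $G$ is the minimum diameter over all strong orientations of $G$. -}

module Defs where

open import Data.Nat using (ℕ; zero; suc; _+_; _*_; _∸_; _≤_; _<_)
open import Data.Nat.DivMod using (_/_; _%_)
open import Data.Fin using (Fin; toℕ)
open import Data.Bool using (Bool; true; false)
open import Data.Product using (Σ; _×_; ∃; ∃-syntax)
open import Data.Sum using (_⊎_)
open import Relation.Binary.PropositionalEquality using (_≡_; _≢_)
open import Relation.Nullary using (¬_)

Graph : ℕ → Set₁
Graph n = Fin n → Fin n → Set

IsOrientation : ∀ {n} → Graph n → (Fin n → Fin n → Bool) → Set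
IsOrientation {n} G O =
  (∀ (u v : Fin n) → O u v ≡ true → G u v) ×
  (∀ (u v : Fin n) → G u v →
     (O u v ≡ true × O v u ≡ false) ⊎ (O u v ≡ false × O v u ≡ true))

data Walk {n : ℕ} (O : Fin n → Fin n → Bool) : Fin n → Fin n → ℕ → Set where
  here : ∀ {u} → Walk O u u 0
  step : ∀ {u w v k} → O u w ≡ true → Walk O w v k → Walk O u v (suc k)

Dist : ∀ {n} → (Fin n → Fin n → Bool) → Fin n → Fin n → ℕ → Set
Dist O u v k = Walk O u v k × (∀ j → j < k → ¬ Walk O u v j)

Strong : ∀ {n} → (Fin n → Fin n → Bool) → Set
Strong {n} O = ∀ (u v : Fin n) → ∃[ k ] Walk O u v k

Diam : ∀ {n} → (Fin n → Fin n → Bool) → ℕ → Set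
Diam {n} O D =
  (∀ (u v : Fin n) → ∃[ k ] (Dist O u v k × k ≤ D)) ×
  (∃[ u ] ∃[ v ] Dist O u v D)

OrientedDiam : ∀ {n} → Graph n → ℕ → Set
OrientedDiam {n} G D =
  (∃[ O ] (IsOrientation G O × Strong O × Diam O D)) ×
  (∀ (O : Fin n → Fin n → Bool) → IsOrientation G O → Strong O →
     ∀ D′ → Diam O D′ → D ≤ D′)

-- The graph G'_n.  Vertex labels (as natural numbers): a_i = 2i, b_i = 2i+1.
-- In the even case the three extra vertices are 2m+1, 2m+2, 2m+3 (= n-3,n-2,n-1).

InTri : ℕ → ℕ → Set
InTri i x = x ≡ 2 * i ⊎ x ≡ 2 * i + 1 ⊎ x ≡ 2 * i + 2

ChainAdj : ℕ → ℕ → ℕ → Set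
ChainAdj m x y = ∃[ i ] (i < m × InTri i x × InTri i y)

K4Adj : ℕ → ℕ → ℕ → Set
K4Adj m x y = (2 * m ≤ x) × (2 * m ≤ y)

G′Adj : ℕ → ℕ → ℕ → ℕ → Set
G′Adj zero    n x y = ChainAdj ((n ∸ 4) / 2) x y ⊎ K4Adj ((n ∸ 4) / 2) x y
G′Adj (suc _) n x y = ChainAdj ((n ∸ 1) / 2) x y

G′ : (n : ℕ) → Graph n
G′ n u v = (toℕ u ≢ toℕ v) × G′Adj (n % 2) n (toℕ u) (toℕ v)

target : ℕ → ℕ
target n with n % 2
... | zero  = (3 * n) / 4
... | suc _ = (3 * (n + 1)) / 4

module Submission where

open import Defs
open import Algebra.Properties.CommutativeSemigroup using (interchange)
open import Data.Bool using (Bool; true; false; not) renaming (_≟_ to _≟ᵇ_)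
open import Data.Bool.Properties using (not-involutive)
open import Data.Empty using (⊥; ⊥-elim)
open import Data.Fin using (Fin; toℕ; fromℕ<)
open import Data.Fin.Properties using (any?)
import Data.Fin.Properties as Fin
open import Data.Nat
open import Data.Nat.DivMod using (m/n*n≤m; m≡m%n+[m/n]*n; m%n<n; [m+kn]%n≡m%n; m*n/n≡m; m*n/m*o≡n/o)
open import Data.Nat.Properties
open import Data.Nat.Tactic.RingSolver using (solve-∀)
open import Data.Parity.Base using (Parity; 0ℙ; 1ℙ; _⁻¹)
open import Data.Parity.Properties using (⁻¹-selfInverse; suc-homo-⁻¹)
open import Data.Product using (Σ-syntax; ∃-syntax; _×_; _,_; proj₁; proj₂)
open import Data.Sum using (_⊎_; inj₁; inj₂)
open import Function using (flip; _∘_)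
open import Relation.Binary.Definitions using (tri<; tri≈; tri>)
open import Relation.Binary.PropositionalEquality
open import Relation.Nullary using (¬_; Dec; yes; no; ¬?)
open import Relation.Unary using (Decidable)

-- Let m be the number of triangles before the final clique (odd n: n = 2m + 3, the last triangle
-- being a 3-clique; even n: n = 2m + 4, with a K₄), so that the claimed value is ⌊(3m + 6)/2⌋.
--
-- In a strong orientation a_0 and b_0 have degree 2, so one of them, s, does not point
-- to a_1; and the clique has a vertex y ≠ a_m with y → a_m. Give s potential 0, a_1 potential 2,
-- let the potential grow from a_i to a_{i+1} by 1 if a_i → a_{i+1} and by 2 otherwise, and give every
-- other vertex of a block (a triangle or the clique) the potential of the block's base plus 1 if the
-- base points to it and plus 2 otherwise. No arc raises the potential by more than 1, so
-- d(s, y) ≥ h + 2 with h the potential of a_m. The same argument for the reversed orientation gives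
-- a pair at distance at least h′ + 2, and since each edge a_i a_{i+1} points forward in exactly one
-- of the two orientations, h + h′ = 3m + 1: two distances sum to 3m + 5.
--
-- Orient the triangles as directed cycles of alternating directions, so that a_i and
-- a_{i+2} are joined both ways by paths of length 3; every vertex is within two steps of both ends
-- of its triangle, and the clique is oriented with diameter 3 and distance at most 2 to and from a_m.

bool-clash : ∀ {b} {A : Set} → b ≡ true → b ≡ false → A
bool-clash refl ()

least-witness : ∀ {P : ℕ → Set} → Decidable P → ∀ {k} → P k →
                ∃[ j ] (j ≤ k × P j × (∀ i → i < j → ¬ P i))
least-witness P? {zero} p = 0 , z≤n , p , λ _ ()
least-witness P? {suc k} p with P? 0
... | yes p₀ = 0 , z≤n , p₀ , λ _ ()
... | no ¬p₀ with least-witness (P? ∘ suc) {k} p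
...   | j , j≤k , pj , below = suc j , s≤s j≤k , pj , λ
        { zero _ → ¬p₀ ; (suc i) (s≤s i<j) → below i i<j }

walk-snoc : ∀ {n} {O : Fin n → Fin n → Bool} {u v w k} →
            Walk O u v k → O v w ≡ true → Walk O u w (suc k)
walk-snoc here       e = step e here
walk-snoc (step d p) e = step d (walk-snoc p e)

module _ {n : ℕ} {O : Fin n → Fin n → Bool} where

  walk-reverse : ∀ {u v k} → Walk O u v k → Walk (flip O) v u k
  walk-reverse here       = here
  walk-reverse (step e p) = walk-snoc (walk-reverse p) e

  walk-potential : (φ : Fin n → ℕ) → (∀ {u w} → O u w ≡ true → φ w ≤ suc (φ u)) →
                   ∀ {u v k} → Walk O u v k → φ v ≤ φ u + k
  walk-potential φ φ-step {u} here = ≤-reflexive (sym (+-identityʳ (φ u)))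
  walk-potential φ φ-step {u} {k = suc k} (step e p) = begin
    φ _             ≤⟨ walk-potential φ φ-step p ⟩
    φ _ + k         ≤⟨ +-monoˡ-≤ k (φ-step e) ⟩
    suc (φ u) + k   ≡⟨ sym (+-suc (φ u) k) ⟩
    φ u + suc k     ∎
    where open ≤-Reasoning

  walk-exit : ∀ {S : Fin n → Set} → Decidable S → ∀ {u v k} → Walk O u v k → S u → ¬ S v →
              ∃[ x ] ∃[ y ] (O x y ≡ true × S x × ¬ S y)
  walk-exit S? here su ¬sv = ⊥-elim (¬sv su)
  walk-exit S? {u} (step {w = w} e p) su ¬sv with S? w
  ... | yes sw = walk-exit S? p sw ¬sv
  ... | no ¬sw = u , w , e , su , ¬sw

  walk? : ∀ k u v → Dec (Walk O u v k)
  walk? zero u v with u Fin.≟ v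
  ... | yes refl = yes here
  ... | no u≢v   = no λ { here → u≢v refl }
  walk? (suc k) u v with any? (λ w → first-step w)
    where
    first-step : ∀ w → Dec (O u w ≡ true × Walk O w v k)
    first-step w with O u w ≟ᵇ true | walk? k w v
    ... | yes e | yes p = yes (e , p)
    ... | no ¬e | _     = no (¬e ∘ proj₁)
    ... | _     | no ¬p = no (¬p ∘ proj₂)
  ... | yes (w , e , p) = yes (step e p)
  ... | no ¬step        = no λ { (step e p) → ¬step (_ , e , p) }

  shortest-walk : ∀ {u v k} → Walk O u v k → ∃[ j ] (Dist O u v j × j ≤ k)
  shortest-walk {u} {v} p with least-witness (λ j → walk? j u v) p
  ... | j , j≤k , pj , below = j , (pj , below) , j≤k

  in-arc : Strong O → ∀ {u} z → u ≢ z → ∃[ x ] O x z ≡ true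
  in-arc strong {u} z u≢z
    with walk-exit (λ w → ¬? (w Fin.≟ z)) (proj₂ (strong u z)) u≢z (λ z≢z → z≢z refl)
  ... | x , y , e , _ , ¬y≢z with y Fin.≟ z
  ...   | yes refl = x , e
  ...   | no  y≢z  = ⊥-elim (¬y≢z y≢z)

Symmetric : ∀ {n} → Graph n → Set
Symmetric {n} G = ∀ {u v : Fin n} → G u v → G v u

module _ {n : ℕ} {G : Graph n} where

  flip-orientation : Symmetric G → ∀ {O} → IsOrientation G O → IsOrientation G (flip O)
  flip-orientation sym (arc⇒edge , edge⇒arc) =
    (λ u v e → sym (arc⇒edge v u e)) , (λ u v g → edge⇒arc v u (sym g))

  orientation-antisym : ∀ {O} → IsOrientation G O → ∀ {u v} → G u v → O u v ≡ not (O v u)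
  orientation-antisym (_ , edge⇒arc) {u} {v} g with edge⇒arc u v g
  ... | inj₁ (uv , vu) rewrite uv | vu = refl
  ... | inj₂ (uv , vu) rewrite uv | vu = refl

  OrientedDiam-cong : ∀ {G′ : Graph n} {D} → (∀ {u v} → G u v → G′ u v) →
                      (∀ {u v} → G′ u v → G u v) → OrientedDiam G D → OrientedDiam G′ D
  OrientedDiam-cong to from ((O , (arc⇒edge , edge⇒arc) , strong , diam) , minimal) =
    (O , ((λ u v e → to (arc⇒edge u v e)) , (λ u v g → edge⇒arc u v (from g))) , strong , diam) ,
    (λ O′ (arc⇒edge′ , edge⇒arc′) →
       minimal O′ ((λ u v e → from (arc⇒edge′ u v e)) , (λ u v g → edge⇒arc′ u v (to g))))

flip-strong : ∀ {n} {O : Fin n → Fin n → Bool} → Strong O → Strong (flip O)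
flip-strong strong u v with strong v u
... | k , p = k , walk-reverse p

half-pigeon : ∀ {T a b} → 2 * T ≤ suc (a + b) → T ≤ a ⊎ T ≤ b
half-pigeon {T} {a} {b} 2T≤ with T ≤? a
... | yes T≤a = inj₁ T≤a
... | no  T≰a = inj₂ (+-cancelˡ-≤ (suc a) T b (begin
  suc a + T        ≤⟨ +-monoˡ-≤ T (≰⇒> T≰a) ⟩
  T + T            ≡⟨ cong (T +_) (sym (+-identityʳ T)) ⟩
  2 * T            ≤⟨ 2T≤ ⟩
  suc a + b        ∎))
  where open ≤-Reasoning

FarPairs : ∀ {n} → (Fin n → Fin n → Bool) → ℕ → Set
FarPairs {n} O T = Σ[ x ∈ Fin n ] Σ[ y ∈ Fin n ] Σ[ x′ ∈ Fin n ] Σ[ y′ ∈ Fin n ]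
  (∀ {j j′} → Walk O x y j → Walk O x′ y′ j′ → 2 * T ≤ suc (j + j′))

oriented-diameter-criterion : ∀ {n} {G : Graph n} {T} →
  (∀ O → IsOrientation G O → Strong O → FarPairs O T) →
  (Σ[ O ∈ (Fin n → Fin n → Bool) ] (IsOrientation G O × (∀ u v → ∃[ l ] (l ≤ T × Walk O u v l)))) →
  OrientedDiam G T
oriented-diameter-criterion {n} {G} {T} far (O , orient , short) = (O , orient , strong , dists , attained) , minimal
  where
  strong : Strong O
  strong u v = proj₁ (short u v) , proj₂ (proj₂ (short u v))

  dists : ∀ u v → ∃[ j ] (Dist O u v j × j ≤ T)
  dists u v with short u v
  ... | l , l≤T , p with shortest-walk p
  ...   | j , d , j≤l = j , d , ≤-trans j≤l l≤T

  attained : ∃[ u ] ∃[ v ] Dist O u v T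
  attained with far O orient strong
  ... | x , y , x′ , y′ , sum with dists x y | dists x′ y′
  ...   | j , d@(p , _) , j≤T | j′ , d′@(p′ , _) , j′≤T with half-pigeon (sum p p′)
  ...     | inj₁ T≤j  = x  , y  , subst (Dist O x y) (≤-antisym j≤T T≤j) d
  ...     | inj₂ T≤j′ = x′ , y′ , subst (Dist O x′ y′) (≤-antisym j′≤T T≤j′) d′

  minimal : ∀ O′ → IsOrientation G O′ → Strong O′ → ∀ D → Diam O′ D → T ≤ D
  minimal O′ orient′ strong′ D (dists′ , _) with far O′ orient′ strong′
  ... | x , y , x′ , y′ , sum with dists′ x y | dists′ x′ y′
  ...   | j , (p , _) , j≤D | j′ , (p′ , _) , j′≤D with half-pigeon (sum p p′)
  ...     | inj₁ T≤j  = ≤-trans T≤j j≤D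
  ...     | inj₂ T≤j′ = ≤-trans T≤j′ j′≤D

data InTriangle (i : ℕ) : ℕ → Set where
  aᵢ   : InTriangle i (i * 2)
  bᵢ   : InTriangle i (suc (i * 2))
  aᵢ₊₁ : InTriangle i (suc i * 2)

-- A chain of k triangles on a_i = 2i, b_i = 2i+1, followed by a clique on all vertices ≥ 2k.
-- Both shapes of G′_n are of this form: for odd n the last triangle of the chain is the clique.
Adjacent : ℕ → ℕ → ℕ → Set
Adjacent k x y = (∃[ i ] (i < k × InTriangle i x × InTriangle i y)) ⊎ (k * 2 ≤ x × k * 2 ≤ y)

ChainClique : (n k : ℕ) → Graph n
ChainClique n k u v = toℕ u ≢ toℕ v × Adjacent k (toℕ u) (toℕ v)

Adjacent-sym : ∀ {k x y} → Adjacent k x y → Adjacent k y x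
Adjacent-sym (inj₁ (i , i<k , tx , ty)) = inj₁ (i , i<k , ty , tx)
Adjacent-sym (inj₂ (K≤x , K≤y))        = inj₂ (K≤y , K≤x)

ChainClique-symmetric : ∀ {n k} → Symmetric (ChainClique n k)
ChainClique-symmetric (u≢v , adj) = u≢v ∘ sym , Adjacent-sym adj

InTriangle-lower : ∀ {i x} → InTriangle i x → i * 2 ≤ x
InTriangle-lower aᵢ   = ≤-refl
InTriangle-lower bᵢ   = n≤1+n _
InTriangle-lower aᵢ₊₁ = ≤-trans (n≤1+n _) (n≤1+n _)

InTriangle-upper : ∀ {i x} → InTriangle i x → x ≤ suc i * 2
InTriangle-upper aᵢ   = ≤-trans (n≤1+n _) (n≤1+n _)
InTriangle-upper bᵢ   = n≤1+n _
InTriangle-upper aᵢ₊₁ = ≤-refl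

record ℕ-Orientation (n k : ℕ) (arc : ℕ → ℕ → Bool) : Set where
  field
    arc⇒edge : ∀ {x y} → x < n → y < n → arc x y ≡ true → x ≢ y × Adjacent k x y
    antisym  : ∀ {x y} → x < n → y < n → x ≢ y → Adjacent k x y → arc x y ≡ not (arc y x)

orientation-from-ℕ : ∀ {n k arc} → ℕ-Orientation n k arc →
                     IsOrientation (ChainClique n k) (λ u v → arc (toℕ u) (toℕ v))
orientation-from-ℕ {arc = arc} orient =
  (λ u v e → arc⇒edge (Fin.toℕ<n u) (Fin.toℕ<n v) e) ,
  (λ u v (u≢v , adj) → one-way (antisym (Fin.toℕ<n u) (Fin.toℕ<n v) u≢v adj))
  where
  open ℕ-Orientation orient
  one-way : ∀ {p q : Bool} → p ≡ not q → (p ≡ true × q ≡ false) ⊎ (p ≡ false × q ≡ true)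
  one-way {q = false} refl = inj₁ (refl , refl)
  one-way {q = true}  refl = inj₂ (refl , refl)

-- O read on vertex labels, with junk value false outside the vertex range
liftℕ : ∀ {n} → (Fin n → Fin n → Bool) → ℕ → ℕ → Bool
liftℕ {n} O x y with x <? n | y <? n
... | yes x<n | yes y<n = O (fromℕ< x<n) (fromℕ< y<n)
... | _       | _       = false

module _ {n : ℕ} (O : Fin n → Fin n → Bool) where

  liftℕ-fromℕ< : ∀ {x y} (x<n : x < n) (y<n : y < n) → liftℕ O x y ≡ O (fromℕ< x<n) (fromℕ< y<n)
  liftℕ-fromℕ< {x} {y} x<n y<n with x <? n | y <? n
  ... | yes _ | yes _ = refl
  ... | no x≮n | _     = ⊥-elim (x≮n x<n)
  ... | yes _ | no y≮n = ⊥-elim (y≮n y<n)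

  liftℕ-toℕ : ∀ u v → liftℕ O (toℕ u) (toℕ v) ≡ O u v
  liftℕ-toℕ u v = trans (liftℕ-fromℕ< (Fin.toℕ<n u) (Fin.toℕ<n v))
                        (cong₂ O (Fin.fromℕ<-toℕ u _) (Fin.fromℕ<-toℕ v _))

  liftℕ-range : ∀ {x y} → liftℕ O x y ≡ true → x < n × y < n
  liftℕ-range {x} {y} e with x <? n | y <? n
  ... | yes x<n | yes y<n = x<n , y<n

  liftℕ-flip : ∀ x y → liftℕ (flip O) x y ≡ liftℕ O y x
  liftℕ-flip x y with x <? n | y <? n
  ... | yes _ | yes _ = refl
  ... | yes _ | no _  = refl
  ... | no _  | yes _ = refl
  ... | no _  | no _  = refl

  orientation-to-ℕ : ∀ {k} → IsOrientation (ChainClique n k) O → ℕ-Orientation n k (liftℕ O)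
  orientation-to-ℕ {k} orient@(arc⇒edge , _) = record
    { arc⇒edge = λ x<n y<n e → relabel x<n y<n (arc⇒edge _ _ (trans (sym (liftℕ-fromℕ< x<n y<n)) e))
    ; antisym  = λ x<n y<n x≢y adj → begin
        liftℕ O _ _                                  ≡⟨ liftℕ-fromℕ< x<n y<n ⟩
        O (fromℕ< x<n) (fromℕ< y<n)                  ≡⟨ orientation-antisym orient (unlabel x<n y<n (x≢y , adj)) ⟩
        not (O (fromℕ< y<n) (fromℕ< x<n))            ≡⟨ cong not (sym (liftℕ-fromℕ< y<n x<n)) ⟩
        not (liftℕ O _ _)                            ∎ }
    where
    open ≡-Reasoning
    Edge : ℕ → ℕ → Set
    Edge x y = x ≢ y × Adjacent k x y
    relabel : ∀ {x y} (x<n : x < n) (y<n : y < n) → Edge (toℕ (fromℕ< x<n)) (toℕ (fromℕ< y<n)) → Edge x y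
    relabel x<n y<n = subst₂ Edge (Fin.toℕ-fromℕ< x<n) (Fin.toℕ-fromℕ< y<n)
    unlabel : ∀ {x y} (x<n : x < n) (y<n : y < n) → Edge x y → Edge (toℕ (fromℕ< x<n)) (toℕ (fromℕ< y<n))
    unlabel x<n y<n = subst₂ Edge (sym (Fin.toℕ-fromℕ< x<n)) (sym (Fin.toℕ-fromℕ< y<n))

cost : Bool → ℕ
cost true  = 1
cost false = 2

1≤cost : ∀ b → 1 ≤ cost b
1≤cost true  = ≤-refl
1≤cost false = s≤s z≤n

cost≤2 : ∀ b → cost b ≤ 2
cost≤2 true  = s≤s z≤n
cost≤2 false = ≤-refl

cost-not : ∀ b → cost (not b) + cost b ≡ 3
cost-not true  = refl
cost-not false = refl

height : (ℕ → ℕ → Bool) → ℕ → ℕ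
height arc zero    = 2
height arc (suc j) = height arc j + cost (arc (suc j * 2) (suc (suc j) * 2))

height-opposite-sum : ∀ (arc arc′ : ℕ → ℕ → Bool) j →
  (∀ i → i < j → arc (suc i * 2) (suc (suc i) * 2) ≡ not (arc′ (suc i * 2) (suc (suc i) * 2))) →
  height arc j + height arc′ j ≡ 4 + 3 * j
height-opposite-sum arc arc′ zero    _        = refl
height-opposite-sum arc arc′ (suc j) opposite = begin
  (h + c) + (h′ + c′)   ≡⟨ interchange +-commutativeSemigroup h c h′ c′ ⟩
  (h + h′) + (c + c′)   ≡⟨ cong₂ _+_ (height-opposite-sum arc arc′ j (λ i i<j → opposite i (m<n⇒m<1+n i<j)))
                                     (trans (cong (λ b → cost b + c′) (opposite j ≤-refl))
                                            (cost-not (arc′ (suc j * 2) (suc (suc j) * 2)))) ⟩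
  4 + 3 * j + 3         ≡⟨ +-assoc 4 (3 * j) 3 ⟩
  4 + (3 * j + 3)       ≡⟨ cong (4 +_) (trans (+-comm (3 * j) 3) (sym (*-suc 3 j))) ⟩
  4 + 3 * suc j         ∎
  where
  open ≡-Reasoning
  h  = height arc j
  h′ = height arc′ j
  c  = cost (arc (suc j * 2) (suc (suc j) * 2))
  c′ = cost (arc′ (suc j * 2) (suc (suc j) * 2))

module _ (arc : ℕ → ℕ → Bool) (φ : ℕ → ℕ) where

  BasedAt : (ℕ → Set) → ℕ → ℕ → Set
  BasedAt B p c = φ p ≡ c × (∀ {z} → B z → z ≢ p → φ z ≡ c + cost (arc p z))

  based-step : ∀ {B p c} → BasedAt B p c → ∀ {x y} → B x → B y → arc x y ≡ true → φ y ≤ suc (φ x)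
  based-step {p = p} {c} (φp , φz) {x} {y} bx by x→y with x ≟ p | y ≟ p
  ... | yes refl | yes refl = n≤1+n _
  ... | yes refl | no y≢p   = begin
    φ y                    ≡⟨ φz by y≢p ⟩
    c + cost (arc x y)     ≡⟨ cong (λ b → c + cost b) x→y ⟩
    c + 1                  ≡⟨ +-comm c 1 ⟩
    suc c                  ≡⟨ cong suc (sym φp) ⟩
    suc (φ x)              ∎
    where open ≤-Reasoning
  ... | no x≢p   | yes refl = begin
    φ y                    ≡⟨ φp ⟩
    c                      ≤⟨ m≤m+n c _ ⟩
    c + cost (arc p x)     ≡⟨ sym (φz bx x≢p) ⟩
    φ x                    ≤⟨ n≤1+n _ ⟩
    suc (φ x)              ∎
    where open ≤-Reasoning
  ... | no x≢p   | no y≢p   = begin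
    φ y                    ≡⟨ φz by y≢p ⟩
    c + cost (arc p y)     ≤⟨ +-monoʳ-≤ c (cost≤2 _) ⟩
    c + 2                  ≡⟨ +-suc c 1 ⟩
    suc (c + 1)            ≤⟨ s≤s (+-monoʳ-≤ c (1≤cost _)) ⟩
    suc (c + cost (arc p x)) ≡⟨ cong suc (sym (φz bx x≢p)) ⟩
    suc (φ x)              ∎
    where open ≤-Reasoning

halve : ℕ → ℕ × Bool
halve zero                = 0 , false
halve (suc zero)          = 0 , true
halve (suc (suc x)) with halve x
... | i , odd = suc i , odd

halve-even : ∀ i → halve (i * 2) ≡ (i , false)
halve-even zero = refl
halve-even (suc i) rewrite halve-even i = refl

halve-odd : ∀ i → halve (suc (i * 2)) ≡ (i , true)
halve-odd zero = refl
halve-odd (suc i) rewrite halve-odd i = refl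

triangle-of : ∀ x → ∃[ i ] InTriangle i x
triangle-of zero                = 0 , aᵢ
triangle-of (suc zero)          = 0 , bᵢ
triangle-of (suc (suc x)) with triangle-of x
... | i , aᵢ   = suc i , aᵢ
... | i , bᵢ   = suc i , bᵢ
... | i , aᵢ₊₁ = suc i , aᵢ₊₁

triangle-below : ∀ {k i x} → i < k → InTriangle i x → x ≤ k * 2
triangle-below i<k tx = ≤-trans (InTriangle-upper tx) (*-monoˡ-≤ 2 i<k)

module LowerBound {n k : ℕ} (O : Fin n → Fin n → Bool) (orient : IsOrientation (ChainClique n (suc k)) O)
                  (strong : Strong O) (room : suc (suc k * 2) < n) where

  K : ℕ
  K = suc k * 2

  arc : ℕ → ℕ → Bool
  arc = liftℕ O

  open ℕ-Orientation (orientation-to-ℕ O orient)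

  arc-edge : ∀ {x y} → arc x y ≡ true → x ≢ y × Adjacent (suc k) x y
  arc-edge e = arc⇒edge (proj₁ (liftℕ-range O e)) (proj₂ (liftℕ-range O e)) e

  arc-asym : ∀ {x y} → arc x y ≡ true → arc y x ≡ false
  arc-asym e with liftℕ-range O e | arc-edge e
  ... | x<n , y<n | x≢y , adj = trans (antisym y<n x<n (x≢y ∘ sym) (Adjacent-sym adj)) (cong not e)

  arc-toℕ : ∀ {u v} → O u v ≡ true → arc (toℕ u) (toℕ v) ≡ true
  arc-toℕ {u} {v} e = trans (liftℕ-toℕ O u v) e

  K<n : K < n
  K<n = ≤-trans (n≤1+n _) room

  clique-closed : ∀ {x y} → K < x → Adjacent (suc k) x y → K ≤ y
  clique-closed K<x (inj₁ (i , i<k , tx , _)) = ⊥-elim (<⇒≱ K<x (triangle-below i<k tx))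
  clique-closed K<x (inj₂ (_ , K≤y))         = K≤y

  first-triangle-closed : ∀ {x z} → z ≤ 1 → Adjacent (suc k) x z → InTriangle 0 x
  first-triangle-closed z≤1 (inj₁ (zero , _ , tx , _)) = tx
  first-triangle-closed (s≤s ()) (inj₁ (suc i , _ , _ , aᵢ))
  first-triangle-closed (s≤s ()) (inj₁ (suc i , _ , _ , bᵢ))
  first-triangle-closed (s≤s ()) (inj₁ (suc i , _ , _ , aᵢ₊₁))
  first-triangle-closed z≤1 (inj₂ (_ , K≤z)) = ⊥-elim (<⇒≱ (≤-<-trans z≤1 (s≤s (s≤s z≤n))) K≤z)

  first-in-arc : ∀ z → z ≤ 1 → ∃[ x ] (x ≢ z × InTriangle 0 x × arc x z ≡ true)
  first-in-arc z z≤1 = relabel (in-arc strong (fromℕ< z<n) a₁≢z)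
    where
    z<n : z < n
    z<n = ≤-<-trans z≤1 (≤-trans (s≤s (s≤s z≤n)) K<n)
    a₁<n : 2 < n
    a₁<n = ≤-trans (s≤s (s≤s (s≤s z≤n))) K<n
    a₁≢z : fromℕ< a₁<n ≢ fromℕ< z<n
    a₁≢z eq = <⇒≢ (≤-<-trans z≤1 ≤-refl)
      (sym (trans (sym (Fin.toℕ-fromℕ< a₁<n)) (trans (cong toℕ eq) (Fin.toℕ-fromℕ< z<n))))
    relabel : ∃[ x ] O x (fromℕ< z<n) ≡ true → ∃[ x ] (x ≢ z × InTriangle 0 x × arc x z ≡ true)
    relabel (x , e) = toℕ x , proj₁ (arc-edge x→z) , first-triangle-closed z≤1 (proj₂ (arc-edge x→z)) , x→z
      where
      x→z : arc (toℕ x) z ≡ true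
      x→z = subst (λ w → arc (toℕ x) w ≡ true) (Fin.toℕ-fromℕ< z<n) (arc-toℕ e)

  -- a_0 and b_0 have no neighbours outside the first triangle, and each needs an in-arc
  source : ∃[ s ] (s ≤ 1 × arc s 2 ≡ false)
  source = by-a₀ (arc 0 2) refl
    where
    both-into-a₁ : arc 0 2 ≡ true → arc 1 2 ≡ true → ∃[ s ] (s ≤ 1 × arc s 2 ≡ false)
    both-into-a₁ 0→2 1→2 = ⊥-elim (into-a₀ (first-in-arc 0 z≤n))
      where
      into-b₀ : ∃[ x ] (x ≢ 1 × InTriangle 0 x × arc x 1 ≡ true) → arc 1 0 ≡ true → ⊥
      into-b₀ (_ , _ , aᵢ , 0→1)   1→0 = bool-clash 0→1 (arc-asym 1→0)
      into-b₀ (_ , x≢1 , bᵢ , _)   _   = x≢1 refl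
      into-b₀ (_ , _ , aᵢ₊₁ , 2→1) _   = bool-clash 2→1 (arc-asym 1→2)

      into-a₀ : ∃[ x ] (x ≢ 0 × InTriangle 0 x × arc x 0 ≡ true) → ⊥
      into-a₀ (_ , x≢0 , aᵢ , _)   = x≢0 refl
      into-a₀ (_ , _ , bᵢ , 1→0)   = into-b₀ (first-in-arc 1 ≤-refl) 1→0
      into-a₀ (_ , _ , aᵢ₊₁ , 2→0) = bool-clash 2→0 (arc-asym 0→2)

    by-b₀ : arc 0 2 ≡ true → ∀ b → arc 1 2 ≡ b → ∃[ s ] (s ≤ 1 × arc s 2 ≡ false)
    by-b₀ 0→2 false 1↛2 = 1 , ≤-refl , 1↛2
    by-b₀ 0→2 true  1→2 = both-into-a₁ 0→2 1→2

    by-a₀ : ∀ b → arc 0 2 ≡ b → ∃[ s ] (s ≤ 1 × arc s 2 ≡ false)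
    by-a₀ false 0↛2 = 0 , z≤n , 0↛2
    by-a₀ true  0→2 = by-b₀ 0→2 (arc 1 2) refl

  clique-exit : ∃[ y ] (K < toℕ y × arc K (toℕ y) ≡ false)
  clique-exit with walk-exit (λ u → K <? toℕ u) (proj₂ (strong (fromℕ< room) (fromℕ< K<n)))
                             (≤-reflexive (sym (Fin.toℕ-fromℕ< room)))
                             (λ K<K → <-irrefl (sym (Fin.toℕ-fromℕ< K<n)) K<K)
  ... | y , w , e , K<y , K≮w with arc-edge (arc-toℕ e)
  ...   | _ , adj = y , K<y , arc-asym (subst (λ v → arc (toℕ y) v ≡ true) w≡K (arc-toℕ e))
    where
    w≡K : toℕ w ≡ K
    w≡K = ≤-antisym (≮⇒≥ K≮w) (clique-closed K<y adj)

  module Potential (s : ℕ) where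

    first : ℕ → ℕ
    first x with x ≟ s
    ... | yes _ = 0
    ... | no _  = cost (arc s x)

    chain : ℕ × Bool → ℕ
    chain (zero  , false) = first 0
    chain (zero  , true)  = first 1
    chain (suc i , false) = height arc i
    chain (suc i , true)  = height arc i + cost (arc (suc i * 2) (suc (suc i * 2)))

    pot : ℕ → ℕ
    pot x with K <? x
    ... | yes _ = height arc k + cost (arc K x)
    ... | no _  = chain (halve x)

    pot-chain : ∀ {x} → x ≤ K → pot x ≡ chain (halve x)
    pot-chain {x} x≤K with K <? x
    ... | yes K<x = ⊥-elim (<⇒≱ K<x x≤K)
    ... | no _    = refl

    pot-clique : ∀ {x} → K < x → pot x ≡ height arc k + cost (arc K x)
    pot-clique {x} K<x with K <? x
    ... | yes _   = refl
    ... | no K≮x  = ⊥-elim (K≮x K<x)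

    pot-a : ∀ {i} → i ≤ suc k → pot (i * 2) ≡ chain (i , false)
    pot-a {i} i≤ = trans (pot-chain (*-monoˡ-≤ 2 i≤)) (cong chain (halve-even i))

    pot-b : ∀ {i} → i < suc k → pot (suc (i * 2)) ≡ chain (i , true)
    pot-b {i} i< = trans (pot-chain (≤-trans (n≤1+n _) (*-monoˡ-≤ 2 i<))) (cong chain (halve-odd i))

    first-base : first s ≡ 0
    first-base with s ≟ s
    ... | yes _  = refl
    ... | no s≢s = ⊥-elim (s≢s refl)

    first-other : ∀ {x} → x ≢ s → first x ≡ cost (arc s x)
    first-other {x} x≢s with x ≟ s
    ... | yes x≡s = ⊥-elim (x≢s x≡s)
    ... | no _    = refl

    pot-source : s ≤ 1 → pot s ≡ 0
    pot-source z≤n       = trans (pot-a z≤n) first-base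
    pot-source (s≤s z≤n) = trans (pot-b (s≤s z≤n)) first-base

    first-based : s ≤ 1 → arc s 2 ≡ false → BasedAt arc pot (InTriangle 0) s 0
    first-based s≤1 s↛2 = pot-source s≤1 , λ
      { aᵢ   z≢s → trans (pot-a z≤n) (first-other z≢s)
      ; bᵢ   z≢s → trans (pot-b (s≤s z≤n)) (first-other z≢s)
      ; aᵢ₊₁ _   → trans (pot-a (s≤s z≤n)) (cong cost (sym s↛2)) }

    triangle-based : ∀ {i} → i < k → BasedAt arc pot (InTriangle (suc i)) (suc i * 2) (height arc i)
    triangle-based i<k = pot-a (<⇒≤ (s≤s i<k)) , λ
      { aᵢ   z≢a → ⊥-elim (z≢a refl)
      ; bᵢ   _   → pot-b (s≤s i<k)
      ; aᵢ₊₁ _   → pot-a (s≤s i<k) }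

    clique-based : BasedAt arc pot (K ≤_) K (height arc k)
    clique-based = pot-a ≤-refl , λ K≤z z≢K → pot-clique (≤∧≢⇒< K≤z (z≢K ∘ sym))

    pot-step : s ≤ 1 → arc s 2 ≡ false → ∀ {x y} → arc x y ≡ true → pot y ≤ suc (pot x)
    pot-step s≤1 s↛2 e with arc-edge e
    ... | _ , inj₁ (zero  , _         , tx , ty) = based-step arc pot (first-based s≤1 s↛2) tx ty e
    ... | _ , inj₁ (suc i , s≤s i<k   , tx , ty) = based-step arc pot (triangle-based i<k) tx ty e
    ... | _ , inj₂ (K≤x , K≤y)                 = based-step arc pot clique-based K≤x K≤y e

  far-pair : Σ[ x ∈ Fin n ] Σ[ y ∈ Fin n ] (∀ {j} → Walk O x y j → height arc k + 2 ≤ j)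
  far-pair = from source clique-exit
    where
    from : ∃[ s ] (s ≤ 1 × arc s 2 ≡ false) → ∃[ y ] (K < toℕ y × arc K (toℕ y) ≡ false) →
           Σ[ x ∈ Fin n ] Σ[ y ∈ Fin n ] (∀ {j} → Walk O x y j → height arc k + 2 ≤ j)
    from (s , s≤1 , s↛2) (y , K<y , K↛y) = fromℕ< s<n , y , λ {j} p → begin
      height arc k + 2                 ≡⟨ cong (λ b → height arc k + cost b) (sym K↛y) ⟩
      height arc k + cost (arc K _)    ≡⟨ sym (pot-clique K<y) ⟩
      pot (toℕ y)                      ≤⟨ walk-potential (pot ∘ toℕ) (pot-step s≤1 s↛2 ∘ arc-toℕ) p ⟩
      pot (toℕ (fromℕ< s<n)) + j       ≡⟨ cong (λ v → pot v + j) (Fin.toℕ-fromℕ< s<n) ⟩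
      pot s + j                        ≡⟨ cong (_+ j) (pot-source s≤1) ⟩
      j                                ∎
      where
      open Potential s
      open ≤-Reasoning
      s<n : s < n
      s<n = ≤-<-trans s≤1 (≤-trans (s≤s (s≤s z≤n)) K<n)

far-pairs : ∀ {n k T} (O : Fin n → Fin n → Bool) → IsOrientation (ChainClique n (suc k)) O → Strong O →
            suc (suc k * 2) < n → 2 * T ≤ 3 * suc k + 6 → FarPairs O T
far-pairs {n} {k} {T} O orient strong room 2T≤ = combine L.far-pair L′.far-pair
  where
  module L  = LowerBound O orient strong room
  module L′ = LowerBound (flip O) (flip-orientation ChainClique-symmetric orient) (flip-strong strong) room
  open ℕ-Orientation (orientation-to-ℕ O orient)

  h  = height (liftℕ O) k
  h′ = height (liftℕ (flip O)) k

  opposite : ∀ i → i < k →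
             liftℕ O (suc i * 2) (suc (suc i) * 2) ≡ not (liftℕ (flip O) (suc i * 2) (suc (suc i) * 2))
  opposite i i<k = trans (antisym a<n b<n (<⇒≢ a<b) (inj₁ (suc i , s≤s i<k , aᵢ , aᵢ₊₁)))
                         (cong not (sym (liftℕ-flip O _ _)))
    where
    a<b : suc i * 2 < suc (suc i) * 2
    a<b = <-trans ≤-refl ≤-refl
    b<n : suc (suc i) * 2 < n
    b<n = ≤-<-trans (*-monoˡ-≤ 2 (s≤s i<k)) (≤-trans (n≤1+n _) room)
    a<n : suc i * 2 < n
    a<n = <-trans a<b b<n

  heights : h + h′ ≡ 4 + 3 * k
  heights = height-opposite-sum (liftℕ O) (liftℕ (flip O)) k opposite

  bound : 3 * suc k + 6 ≡ suc ((h + 2) + (h′ + 2))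
  bound = begin
    3 * suc k + 6            ≡⟨ trans (+-comm (3 * suc k) 6) (cong (6 +_) (*-suc 3 k)) ⟩
    5 + (4 + 3 * k)          ≡⟨ cong (5 +_) (sym heights) ⟩
    5 + (h + h′)             ≡⟨ cong suc (+-comm 4 (h + h′)) ⟩
    suc ((h + h′) + (2 + 2)) ≡⟨ cong suc (interchange +-commutativeSemigroup h h′ 2 2) ⟩
    suc ((h + 2) + (h′ + 2)) ∎
    where open ≡-Reasoning

  combine : Σ[ x ∈ Fin n ] Σ[ y ∈ Fin n ] (∀ {j} → Walk O x y j → h + 2 ≤ j) →
            Σ[ y′ ∈ Fin n ] Σ[ x′ ∈ Fin n ] (∀ {j} → Walk (flip O) y′ x′ j → h′ + 2 ≤ j) →
            FarPairs O T
  combine (x , y , far) (y′ , x′ , far′) = x , y , x′ , y′ , λ {j} {j′} p p′ → begin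
    2 * T                      ≤⟨ 2T≤ ⟩
    3 * suc k + 6              ≡⟨ bound ⟩
    suc ((h + 2) + (h′ + 2))   ≤⟨ s≤s (+-mono-≤ (far p) (far′ (walk-reverse p′))) ⟩
    suc (j + j′)               ∎
    where open ≤-Reasoning

record Cyclic (arc : ℕ → ℕ → Bool) (p q r : ℕ) : Set where
  field
    p→q : arc p q ≡ true
    q→r : arc q r ≡ true
    r→p : arc r p ≡ true
    q↛p : arc q p ≡ false
    r↛q : arc r q ≡ false
    p↛r : arc p r ≡ false

In3 : ℕ → ℕ → ℕ → ℕ → Set
In3 p q r x = x ≡ p ⊎ x ≡ q ⊎ x ≡ r

Cyclic-antisym : ∀ {arc p q r} → Cyclic arc p q r → ∀ {x y} → In3 p q r x → In3 p q r y → x ≢ y →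
                 arc x y ≡ not (arc y x)
Cyclic-antisym c (inj₁ refl)        (inj₁ refl)        x≢y = ⊥-elim (x≢y refl)
Cyclic-antisym c (inj₁ refl)        (inj₂ (inj₁ refl)) _   rewrite Cyclic.p→q c | Cyclic.q↛p c = refl
Cyclic-antisym c (inj₁ refl)        (inj₂ (inj₂ refl)) _   rewrite Cyclic.p↛r c | Cyclic.r→p c = refl
Cyclic-antisym c (inj₂ (inj₁ refl)) (inj₁ refl)        _   rewrite Cyclic.q↛p c | Cyclic.p→q c = refl
Cyclic-antisym c (inj₂ (inj₁ refl)) (inj₂ (inj₁ refl)) x≢y = ⊥-elim (x≢y refl)
Cyclic-antisym c (inj₂ (inj₁ refl)) (inj₂ (inj₂ refl)) _   rewrite Cyclic.q→r c | Cyclic.r↛q c = refl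
Cyclic-antisym c (inj₂ (inj₂ refl)) (inj₁ refl)        _   rewrite Cyclic.r→p c | Cyclic.p↛r c = refl
Cyclic-antisym c (inj₂ (inj₂ refl)) (inj₂ (inj₁ refl)) _   rewrite Cyclic.r↛q c | Cyclic.q→r c = refl
Cyclic-antisym c (inj₂ (inj₂ refl)) (inj₂ (inj₂ refl)) x≢y = ⊥-elim (x≢y refl)

CyclicTriangle : (ℕ → ℕ → Bool) → ℕ → Parity → Set
CyclicTriangle arc i 0ℙ = Cyclic arc (i * 2) (suc (i * 2)) (suc i * 2)
CyclicTriangle arc i 1ℙ = Cyclic arc (i * 2) (suc i * 2) (suc (i * 2))

InTriangle⇒In3 : ∀ {i x} → InTriangle i x → In3 (i * 2) (suc (i * 2)) (suc i * 2) x
InTriangle⇒In3 aᵢ   = inj₁ refl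
InTriangle⇒In3 bᵢ   = inj₂ (inj₁ refl)
InTriangle⇒In3 aᵢ₊₁ = inj₂ (inj₂ refl)

InTriangle⇒In3′ : ∀ {i x} → InTriangle i x → In3 (i * 2) (suc i * 2) (suc (i * 2)) x
InTriangle⇒In3′ aᵢ   = inj₁ refl
InTriangle⇒In3′ bᵢ   = inj₂ (inj₂ refl)
InTriangle⇒In3′ aᵢ₊₁ = inj₂ (inj₁ refl)

CyclicTriangle-antisym : ∀ {arc i} d → CyclicTriangle arc i d →
                         ∀ {x y} → InTriangle i x → InTriangle i y → x ≢ y → arc x y ≡ not (arc y x)
CyclicTriangle-antisym 0ℙ c tx ty = Cyclic-antisym c (InTriangle⇒In3 tx) (InTriangle⇒In3 ty)
CyclicTriangle-antisym 1ℙ c tx ty = Cyclic-antisym c (InTriangle⇒In3′ tx) (InTriangle⇒In3′ ty)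

module Routes (n : ℕ) (arc : ℕ → ℕ → Bool) where

  data Route : ℕ → ℕ → ℕ → Set where
    stay : ∀ {x} → Route x x 0
    hop  : ∀ {x w y l} → arc x w ≡ true → w < n → Route w y l → Route x y (suc l)

  _++_ : ∀ {x y z l m} → Route x y l → Route y z m → Route x z (l + m)
  stay         ++ r = r
  hop e w<n r′ ++ r = hop e w<n (r′ ++ r)

  Within : ℕ → ℕ → ℕ → Set
  Within m x y = ∃[ l ] (l ≤ m × Route x y l)

  within-++ : ∀ {x y z a b} → Within a x y → Within b y z → Within (a + b) x z
  within-++ (l , l≤a , r) (l′ , l′≤b , r′) = l + l′ , +-mono-≤ l≤a l′≤b , r ++ r′

  within-mono : ∀ {a b x y} → a ≤ b → Within a x y → Within b x y
  within-mono a≤b (l , l≤a , r) = l , ≤-trans l≤a a≤b , r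

  OnFin : Fin n → Fin n → Bool
  OnFin u v = arc (toℕ u) (toℕ v)

  Route⇒Walk : ∀ {x y l} (x<n : x < n) (y<n : y < n) → Route x y l → Walk OnFin (fromℕ< x<n) (fromℕ< y<n) l
  Route⇒Walk x<n y<n stay = here
  Route⇒Walk x<n y<n (hop e w<n r) =
    step (subst₂ (λ a b → arc a b ≡ true) (sym (Fin.toℕ-fromℕ< x<n)) (sym (Fin.toℕ-fromℕ< w<n)) e)
         (Route⇒Walk w<n y<n r)

  Within⇒Walk : ∀ {m} (u v : Fin n) → Within m (toℕ u) (toℕ v) → ∃[ l ] (l ≤ m × Walk OnFin u v l)
  Within⇒Walk u v (l , l≤m , r) = l , l≤m ,
    subst₂ (λ a b → Walk OnFin a b l) (Fin.fromℕ<-toℕ u _) (Fin.fromℕ<-toℕ v _)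
           (Route⇒Walk (Fin.toℕ<n u) (Fin.toℕ<n v) r)

  Cyclic-within : ∀ {p q r} → Cyclic arc p q r → p < n → q < n → r < n →
                  ∀ {x y} → In3 p q r x → In3 p q r y → Within 2 x y
  Cyclic-within c p<n q<n r<n = go
    where
    open Cyclic c
    go : ∀ {x y} → In3 _ _ _ x → In3 _ _ _ y → Within 2 x y
    go (inj₁ refl)        (inj₁ refl)        = 0 , z≤n , stay
    go (inj₁ refl)        (inj₂ (inj₁ refl)) = 1 , s≤s z≤n , hop p→q q<n stay
    go (inj₁ refl)        (inj₂ (inj₂ refl)) = 2 , ≤-refl , hop p→q q<n (hop q→r r<n stay)
    go (inj₂ (inj₁ refl)) (inj₁ refl)        = 2 , ≤-refl , hop q→r r<n (hop r→p p<n stay)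
    go (inj₂ (inj₁ refl)) (inj₂ (inj₁ refl)) = 0 , z≤n , stay
    go (inj₂ (inj₁ refl)) (inj₂ (inj₂ refl)) = 1 , s≤s z≤n , hop q→r r<n stay
    go (inj₂ (inj₂ refl)) (inj₁ refl)        = 1 , s≤s z≤n , hop r→p p<n stay
    go (inj₂ (inj₂ refl)) (inj₂ (inj₁ refl)) = 2 , ≤-refl , hop r→p p<n (hop p→q q<n stay)
    go (inj₂ (inj₂ refl)) (inj₂ (inj₂ refl)) = 0 , z≤n , stay

  CyclicTriangle-within : ∀ {i} d → CyclicTriangle arc i d → suc i * 2 < n →
                          ∀ {x y} → InTriangle i x → InTriangle i y → Within 2 x y
  CyclicTriangle-within 0ℙ c a′<n tx ty =
    Cyclic-within c (<-trans (n<1+n _) b<n) b<n a′<n (InTriangle⇒In3 tx) (InTriangle⇒In3 ty)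
    where b<n = <-trans (n<1+n _) a′<n
  CyclicTriangle-within 1ℙ c a′<n tx ty =
    Cyclic-within c (<-trans (n<1+n _) b<n) a′<n b<n (InTriangle⇒In3′ tx) (InTriangle⇒In3′ ty)
    where b<n = <-trans (n<1+n _) a′<n

  across-two : ∀ {i} d → CyclicTriangle arc i d → CyclicTriangle arc (suc i) (d ⁻¹) → suc (suc i) * 2 < n →
               Route (i * 2) (suc (suc i) * 2) 3 × Route (suc (suc i) * 2) (i * 2) 3
  across-two 0ℙ c c′ a″<n =
    hop (Cyclic.p→q c) b<n (hop (Cyclic.q→r c) a′<n (hop (Cyclic.p→q c′) a″<n stay)) ,
    hop (Cyclic.q→r c′) b′<n (hop (Cyclic.r→p c′) a′<n (hop (Cyclic.r→p c) a<n stay))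
    where
    b′<n = <-trans (n<1+n _) a″<n
    a′<n = <-trans (n<1+n _) b′<n
    b<n  = <-trans (n<1+n _) a′<n
    a<n  = <-trans (n<1+n _) b<n
  across-two 1ℙ c c′ a″<n =
    hop (Cyclic.p→q c) a′<n (hop (Cyclic.p→q c′) b′<n (hop (Cyclic.q→r c′) a″<n stay)) ,
    hop (Cyclic.r→p c′) a′<n (hop (Cyclic.q→r c) b<n (hop (Cyclic.r→p c) a<n stay))
    where
    b′<n = <-trans (n<1+n _) a″<n
    a′<n = <-trans (n<1+n _) b′<n
    b<n  = <-trans (n<1+n _) a′<n
    a<n  = <-trans (n<1+n _) b<n

  Alternating : ℕ → Set
  Alternating m = ∀ t → t < m → CyclicTriangle arc t (parity t)

  -- along L triangles with three steps for every two of them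
  FastRoute : ℕ → ℕ → ℕ → Set
  FastRoute x y L = ∃[ S ] (Route x y S × 2 * S ≤ 3 * L + 1)

  along-chain : ∀ {m} → Alternating m → m * 2 < n → ∀ L i → i + L ≤ m →
                FastRoute (i * 2) ((i + L) * 2) L × FastRoute ((i + L) * 2) (i * 2) L
  along-chain alt m<n zero i _ rewrite +-identityʳ i = (0 , stay , z≤n) , (0 , stay , z≤n)
  along-chain alt m<n (suc zero) i i+1≤m rewrite +-comm i 1 =
    one (CyclicTriangle-within (parity i) c a′<n aᵢ aᵢ₊₁) ,
    one (CyclicTriangle-within (parity i) c a′<n aᵢ₊₁ aᵢ)
    where
    c = alt i i+1≤m
    a′<n = ≤-<-trans (*-monoˡ-≤ 2 i+1≤m) m<n
    one : ∀ {x y} → Within 2 x y → FastRoute x y 1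
    one (l , l≤2 , r) = l , r , *-monoʳ-≤ 2 l≤2
  along-chain {m} alt m<n (suc (suc L)) i i+L+2≤m
    rewrite +-suc i (suc L) | +-suc i L
    with along-chain alt m<n L (suc (suc i)) i+L+2≤m
  ... | (S , r , 2S≤) , (S′ , r′ , 2S′≤) =
    (3 + S , there ++ r , extend S 2S≤) ,
    (S′ + 3 , r′ ++ back , subst (λ z → 2 * z ≤ 3 * suc (suc L) + 1) (+-comm 3 S′) (extend S′ 2S′≤))
    where
    i+2≤m : suc (suc i) ≤ m
    i+2≤m = ≤-trans (s≤s (s≤s (m≤m+n i L))) i+L+2≤m
    opposite : CyclicTriangle arc (suc i) (parity i ⁻¹)
    opposite = subst (CyclicTriangle arc (suc i)) (sym (⁻¹-selfInverse (suc-homo-⁻¹ i))) (alt (suc i) i+2≤m)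
    there-back = across-two (parity i) (alt i (≤-trans (n≤1+n _) i+2≤m)) opposite
                            (≤-<-trans (*-monoˡ-≤ 2 i+2≤m) m<n)
    there = proj₁ there-back
    back = proj₂ there-back
    extend : ∀ S → 2 * S ≤ 3 * L + 1 → 2 * (3 + S) ≤ 3 * suc (suc L) + 1
    extend S 2S≤ = begin
      2 * (3 + S)          ≡⟨ *-distribˡ-+ 2 3 S ⟩
      6 + 2 * S            ≤⟨ +-monoʳ-≤ 6 2S≤ ⟩
      6 + (3 * L + 1)      ≡⟨ sym (+-assoc 6 (3 * L) 1) ⟩
      6 + 3 * L + 1        ≡⟨ cong (_+ 1) (sym (*-distribˡ-+ 3 2 L)) ⟩
      3 * suc (suc L) + 1  ∎
      where open ≤-Reasoning

  module ChainRoutes {m : ℕ} (alt : Alternating m) (m*2<n : m * 2 < n)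
    (clique-hub : ∀ {x} → m * 2 ≤ x → x < n → Within 2 x (m * 2) × Within 2 (m * 2) x)
    (clique-within : ∀ {x y} → m * 2 ≤ x → x < n → m * 2 ≤ y → y < n → Within 3 x y) where

    data Block (x : ℕ) : ℕ → Set where
      triangle : ∀ {j} → j < m → InTriangle j x → Block x j
      clique   : m * 2 ≤ x → x < n → Block x m

    cover : ∀ {x} → x < n → ∃[ j ] (j ≤ m × Block x j)
    cover {x} x<n with m * 2 ≤? x
    ... | yes M≤x = m , ≤-refl , clique M≤x x<n
    ... | no  M≰x with triangle-of x
    ...   | i , t = i , <⇒≤ i<m , triangle i<m t
      where
      i<m : i < m
      i<m = *-cancelʳ-< 2 i m (≤-<-trans (InTriangle-lower t) (≰⇒> M≰x))

    a′<n : ∀ {j} → j < m → suc j * 2 < n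
    a′<n j<m = ≤-<-trans (*-monoˡ-≤ 2 j<m) m*2<n

    hub : ∀ {x j} → Block x j → Within 2 x (j * 2) × Within 2 (j * 2) x
    hub (triangle {j} j<m t) = CyclicTriangle-within (parity j) (alt j j<m) (a′<n j<m) t aᵢ ,
                               CyclicTriangle-within (parity j) (alt j j<m) (a′<n j<m) aᵢ t
    hub (clique M≤x x<n)     = clique-hub M≤x x<n

    exit : ∀ {x j} → j < m → InTriangle j x → Within 2 x (suc j * 2) × Within 2 (suc j * 2) x
    exit {j = j} j<m t = CyclicTriangle-within (parity j) (alt j j<m) (a′<n j<m) t aᵢ₊₁ ,
                         CyclicTriangle-within (parity j) (alt j j<m) (a′<n j<m) aᵢ₊₁ t

    Block-triangle : ∀ {x j} → Block x j → j < m → InTriangle j x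
    Block-triangle (triangle _ t) _   = t
    Block-triangle (clique _ _)   m<m = ⊥-elim (<-irrefl refl m<m)

    same-block : ∀ {x y j} → Block x j → Block y j → Within 3 x y
    same-block (triangle {j} j<m tx) (triangle _ ty) =
      within-mono (n≤1+n 2) (CyclicTriangle-within (parity j) (alt j j<m) (a′<n j<m) tx ty)
    same-block (triangle m<m _) (clique _ _)         = ⊥-elim (<-irrefl refl m<m)
    same-block (clique _ _)     (triangle m<m _)     = ⊥-elim (<-irrefl refl m<m)
    same-block (clique M≤x x<n) (clique M≤y y<n)     = clique-within M≤x x<n M≤y y<n

    chain-between : ∀ {i j} → i < j → j ≤ m →
                    ∃[ L ] (L < m × FastRoute (suc i * 2) (j * 2) L × FastRoute (j * 2) (suc i * 2) L)
    chain-between {i} {j} i<j j≤m =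
      L , ≤-trans (s≤s (m≤n+m L i)) i+1+L≤m ,
      subst (λ j → FastRoute (suc i * 2) (j * 2) L) ends (proj₁ chain) ,
      subst (λ j → FastRoute (j * 2) (suc i * 2) L) ends (proj₂ chain)
      where
      L = j ∸ suc i
      ends : suc i + L ≡ j
      ends = m+[n∸m]≡n i<j
      i+1+L≤m : suc i + L ≤ m
      i+1+L≤m = subst (_≤ m) (sym ends) j≤m
      chain = along-chain alt m*2<n L (suc i) i+1+L≤m

    module _ {T : ℕ} (3m+5≤2T : 3 * m + 5 ≤ 2 * T) where

      length-bound : ∀ {a S b L} → a ≤ 2 → b ≤ 2 → 2 * S ≤ 3 * L + 1 → L < m → a + (S + b) ≤ T
      length-bound {a} {S} {b} {L} a≤2 b≤2 2S≤ L<m = ≤-pred (*-cancelˡ-< 2 _ _ (begin-strict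
        2 * (a + (S + b))          ≡⟨ distrib a S b ⟩
        2 * a + 2 * S + 2 * b      ≤⟨ +-mono-≤ (+-mono-≤ (*-monoʳ-≤ 2 a≤2) 2S≤) (*-monoʳ-≤ 2 b≤2) ⟩
        4 + (3 * L + 1) + 4        ≡⟨ regroup L ⟩
        3 * suc L + 6              ≤⟨ +-monoˡ-≤ 6 (*-monoʳ-≤ 3 L<m) ⟩
        3 * m + 6                  ≡⟨ +-suc (3 * m) 5 ⟩
        suc (3 * m + 5)            ≤⟨ s≤s 3m+5≤2T ⟩
        suc (2 * T)                <⟨ n<1+n _ ⟩
        suc (suc (2 * T))          ≡⟨ sym (*-suc 2 T) ⟩
        2 * suc T                  ∎))
        where
        open ≤-Reasoning
        distrib : ∀ a S b → 2 * (a + (S + b)) ≡ 2 * a + 2 * S + 2 * b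
        distrib = solve-∀
        regroup : ∀ L → 4 + (3 * L + 1) + 4 ≡ 3 * suc L + 6
        regroup = solve-∀

      3≤T : 3 ≤ T
      3≤T = *-cancelˡ-< 2 2 T (≤-trans (m≤n+m 5 (3 * m)) 3m+5≤2T)

      via-chain : ∀ {x y z w L} → Within 2 x y → FastRoute y z L → Within 2 z w → L < m → Within T x w
      via-chain (a , a≤2 , r₁) (S , r₂ , 2S≤) (b , b≤2 , r₃) L<m =
        a + (S + b) , length-bound a≤2 b≤2 2S≤ L<m , r₁ ++ (r₂ ++ r₃)

      route : ∀ {x y} → x < n → y < n → Within T x y
      route x<n y<n = between (cover x<n) (cover y<n)
        where
        between : ∀ {x y} → ∃[ j ] (j ≤ m × Block x j) → ∃[ j ] (j ≤ m × Block y j) → Within T x y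
        between (j₁ , j₁≤m , bx) (j₂ , j₂≤m , by) with <-cmp j₁ j₂
        ... | tri≈ _ refl _ = within-mono 3≤T (same-block bx by)
        ... | tri< j₁<j₂ _ _ with chain-between j₁<j₂ j₂≤m
        ...   | L , L<m , forward , _ =
          via-chain (proj₁ (exit j₁<m (Block-triangle bx j₁<m))) forward (proj₂ (hub by)) L<m
          where j₁<m = <-≤-trans j₁<j₂ j₂≤m
        between (j₁ , j₁≤m , bx) (j₂ , j₂≤m , by) | tri> _ _ j₂<j₁ with chain-between j₂<j₁ j₁≤m
        ...   | L , L<m , _ , backward =
          via-chain (proj₁ (hub bx)) backward (proj₂ (exit j₂<m (Block-triangle by j₂<m))) L<m
          where j₂<m = <-≤-trans j₂<j₁ j₁≤m

-- chainArc′ x y stands for chainArc (4 + x) y: the orientation of the first two triangles repeats.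
chainArc  : ℕ → ℕ → Bool
chainArc′ : ℕ → ℕ → Bool
chainArc 0 1 = true
chainArc 0 _ = false
chainArc 1 2 = true
chainArc 1 _ = false
chainArc 2 0 = true
chainArc 2 4 = true
chainArc 2 _ = false
chainArc 3 2 = true
chainArc 3 _ = false
chainArc (suc (suc (suc (suc x)))) y = chainArc′ x y
chainArc′ x (suc (suc (suc (suc y)))) = chainArc x y
chainArc′ 0 3 = true
chainArc′ _ _ = false

chainArc-irrefl : ∀ x → chainArc x x ≡ false
chainArc-irrefl 0 = refl
chainArc-irrefl 1 = refl
chainArc-irrefl 2 = refl
chainArc-irrefl 3 = refl
chainArc-irrefl (suc (suc (suc (suc x)))) = chainArc-irrefl x

chainArc-triangle : ∀ {x y} → chainArc x y ≡ true → ∃[ t ] (InTriangle t x × InTriangle t y)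
chainArc-triangle {0} {1} _ = 0 , aᵢ , bᵢ
chainArc-triangle {1} {2} _ = 0 , bᵢ , aᵢ₊₁
chainArc-triangle {2} {0} _ = 0 , aᵢ₊₁ , aᵢ
chainArc-triangle {2} {4} _ = 1 , aᵢ , aᵢ₊₁
chainArc-triangle {3} {2} _ = 1 , bᵢ , aᵢ
chainArc-triangle {4} {3} _ = 1 , aᵢ₊₁ , bᵢ
chainArc-triangle {suc (suc (suc (suc x)))} {suc (suc (suc (suc y)))} e with chainArc-triangle {x} {y} e
... | t , tx , ty = suc (suc t) , shift tx , shift ty
  where
  shift : ∀ {z} → InTriangle t z → InTriangle (suc (suc t)) (suc (suc (suc (suc z))))
  shift aᵢ   = aᵢ
  shift bᵢ   = bᵢ
  shift aᵢ₊₁ = aᵢ₊₁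

chainArc-cyclic : ∀ i → CyclicTriangle chainArc i (parity i)
chainArc-cyclic 0 = record { p→q = refl ; q→r = refl ; r→p = refl ; q↛p = refl ; r↛q = refl ; p↛r = refl }
chainArc-cyclic 1 = record { p→q = refl ; q→r = refl ; r→p = refl ; q↛p = refl ; r↛q = refl ; p↛r = refl }
chainArc-cyclic (suc (suc i)) = shift (parity i) (chainArc-cyclic i)
  where
  shift₄ : ∀ {p q r} → Cyclic chainArc p q r → Cyclic chainArc (4 + p) (4 + q) (4 + r)
  shift₄ c = record { Cyclic c }
  shift : ∀ d → CyclicTriangle chainArc i d → CyclicTriangle chainArc (suc (suc i)) d
  shift 0ℙ = shift₄
  shift 1ℙ = shift₄

-- An orientation of K₄ on offsets 0..3 (from a_m) with all distances at most 3; it restricts to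
-- the directed triangle 0 → 1 → 2 → 0, which orients the 3-vertex clique of the odd case.
cliqueArc : ℕ → ℕ → Bool
cliqueArc 0 1 = true
cliqueArc 1 2 = true
cliqueArc 2 0 = true
cliqueArc 1 3 = true
cliqueArc 3 0 = true
cliqueArc 3 2 = true
cliqueArc _ _ = false

cliqueArc-irrefl : ∀ c → cliqueArc c c ≡ false
cliqueArc-irrefl 0 = refl
cliqueArc-irrefl 1 = refl
cliqueArc-irrefl 2 = refl
cliqueArc-irrefl 3 = refl
cliqueArc-irrefl (suc (suc (suc (suc c)))) = refl

cliqueArc-antisym-< : ∀ {c d} → c < d → d < 4 → cliqueArc c d ≡ not (cliqueArc d c)
cliqueArc-antisym-< {0} {1} _ _ = refl
cliqueArc-antisym-< {0} {2} _ _ = refl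
cliqueArc-antisym-< {0} {3} _ _ = refl
cliqueArc-antisym-< {1} {2} _ _ = refl
cliqueArc-antisym-< {1} {3} _ _ = refl
cliqueArc-antisym-< {2} {3} _ _ = refl
cliqueArc-antisym-< {_} {suc (suc (suc (suc _)))} _ (s≤s (s≤s (s≤s (s≤s ()))))
cliqueArc-antisym-< {suc _} {1} (s≤s ()) _
cliqueArc-antisym-< {suc (suc _)} {2} (s≤s (s≤s ())) _
cliqueArc-antisym-< {suc (suc (suc _))} {3} (s≤s (s≤s (s≤s ()))) _

cliqueArc-antisym : ∀ {c d} → c < 4 → d < 4 → c ≢ d → cliqueArc c d ≡ not (cliqueArc d c)
cliqueArc-antisym {c} {d} c<4 d<4 c≢d with <-cmp c d
... | tri< c<d _ _ = cliqueArc-antisym-< c<d d<4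
... | tri≈ _ c≡d _ = ⊥-elim (c≢d c≡d)
... | tri> _ _ d<c = trans (sym (not-involutive _)) (cong not (sym (cliqueArc-antisym-< d<c c<4)))

offset : ∀ {K s x} → K ≤ x → x < s + K → ∃[ c ] (c < s × x ≡ c + K)
offset {K} {s} {x} K≤x x<s+K =
  x ∸ K , +-cancelʳ-< K (x ∸ K) s (subst (_< s + K) (sym (m∸n+n≡m K≤x)) x<s+K) , sym (m∸n+n≡m K≤x)

module Construction (k s : ℕ) (3≤s : 3 ≤ s) (s≤4 : s ≤ 4) where

  K : ℕ
  K = suc k * 2

  n : ℕ
  n = s + K

  arc : ℕ → ℕ → Bool
  arc x y with K ≤? x | K ≤? y
  ... | yes _ | yes _ = cliqueArc (x ∸ K) (y ∸ K)
  ... | _     | _     = chainArc x y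

  arc-cases : ∀ x y → (K ≤ x × K ≤ y × arc x y ≡ cliqueArc (x ∸ K) (y ∸ K)) ⊎
                      ((x < K ⊎ y < K) × arc x y ≡ chainArc x y)
  arc-cases x y with K ≤? x | K ≤? y
  ... | yes K≤x | yes K≤y = inj₁ (K≤x , K≤y , refl)
  ... | yes _   | no K≰y  = inj₂ (inj₂ (≰⇒> K≰y) , refl)
  ... | no K≰x  | _       = inj₂ (inj₁ (≰⇒> K≰x) , refl)

  arc-chain : ∀ {x y} → x < K ⊎ y < K → arc x y ≡ chainArc x y
  arc-chain {x} {y} low with arc-cases x y
  ... | inj₂ (_ , e)            = e
  ... | inj₁ (K≤x , K≤y , _) with low
  ...   | inj₁ x<K = ⊥-elim (<⇒≱ x<K K≤x)
  ...   | inj₂ y<K = ⊥-elim (<⇒≱ y<K K≤y)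

  arc-clique : ∀ c d → arc (c + K) (d + K) ≡ cliqueArc c d
  arc-clique c d with arc-cases (c + K) (d + K)
  ... | inj₁ (_ , _ , e) = trans e (cong₂ cliqueArc (m+n∸n≡m c K) (m+n∸n≡m d K))
  ... | inj₂ (inj₁ c+K<K , _) = ⊥-elim (<⇒≱ c+K<K (m≤n+m K c))
  ... | inj₂ (inj₂ d+K<K , _) = ⊥-elim (<⇒≱ d+K<K (m≤n+m K d))

  alternating : ∀ t → t < suc k → CyclicTriangle arc t (parity t)
  alternating t t<m = transfer (parity t) (chainArc-cyclic t)
    where
    b<K : suc (t * 2) < K
    b<K = *-monoˡ-≤ 2 t<m
    a<K : t * 2 < K
    a<K = <-trans (n<1+n _) b<K
    a = t * 2
    b = suc (t * 2)
    a′ = suc t * 2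
    transfer : ∀ d → CyclicTriangle chainArc t d → CyclicTriangle arc t d
    transfer 0ℙ c = record
      { p→q = trans (arc-chain {a} {b} (inj₁ a<K)) (Cyclic.p→q c)
      ; q→r = trans (arc-chain {b} {a′} (inj₁ b<K)) (Cyclic.q→r c)
      ; r→p = trans (arc-chain {a′} {a} (inj₂ a<K)) (Cyclic.r→p c)
      ; q↛p = trans (arc-chain {b} {a} (inj₁ b<K)) (Cyclic.q↛p c)
      ; r↛q = trans (arc-chain {a′} {b} (inj₂ b<K)) (Cyclic.r↛q c)
      ; p↛r = trans (arc-chain {a} {a′} (inj₁ a<K)) (Cyclic.p↛r c) }
    transfer 1ℙ c = record
      { p→q = trans (arc-chain {a} {a′} (inj₁ a<K)) (Cyclic.p→q c)
      ; q→r = trans (arc-chain {a′} {b} (inj₂ b<K)) (Cyclic.q→r c)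
      ; r→p = trans (arc-chain {b} {a} (inj₁ b<K)) (Cyclic.r→p c)
      ; q↛p = trans (arc-chain {a′} {a} (inj₂ a<K)) (Cyclic.q↛p c)
      ; r↛q = trans (arc-chain {b} {a′} (inj₁ b<K)) (Cyclic.r↛q c)
      ; p↛r = trans (arc-chain {a} {b} (inj₁ a<K)) (Cyclic.p↛r c) }

  orientation : ℕ-Orientation n (suc k) arc
  orientation = record { arc⇒edge = arc⇒edge ; antisym = antisym }
    where
    arc⇒edge : ∀ {x y} → x < n → y < n → arc x y ≡ true → x ≢ y × Adjacent (suc k) x y
    arc⇒edge {x} {y} _ _ e with arc-cases x y
    ... | inj₁ (K≤x , K≤y , e′) =
      (λ { refl → bool-clash (trans (sym e′) e) (cliqueArc-irrefl (x ∸ K)) }) ,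
      inj₂ (K≤x , K≤y)
    ... | inj₂ (low , e′) with chainArc-triangle (trans (sym e′) e)
    ...   | t , tx , ty =
      (λ { refl → bool-clash (trans (sym e′) e) (chainArc-irrefl x) }) ,
      inj₁ (t , t<m low , tx , ty)
      where
      t<m : x < K ⊎ y < K → t < suc k
      t<m (inj₁ x<K) = *-cancelʳ-< 2 t (suc k) (≤-<-trans (InTriangle-lower tx) x<K)
      t<m (inj₂ y<K) = *-cancelʳ-< 2 t (suc k) (≤-<-trans (InTriangle-lower ty) y<K)

    antisym : ∀ {x y} → x < n → y < n → x ≢ y → Adjacent (suc k) x y → arc x y ≡ not (arc y x)
    antisym _ _ x≢y (inj₁ (t , t<m , tx , ty)) = CyclicTriangle-antisym (parity t) (alternating t t<m) tx ty x≢y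
    antisym x<n y<n x≢y (inj₂ (K≤x , K≤y)) with offset K≤x x<n | offset K≤y y<n
    ... | c , c<s , refl | d , d<s , refl =
      trans (arc-clique c d)
            (trans (cliqueArc-antisym (≤-trans c<s s≤4) (≤-trans d<s s≤4) (λ { refl → x≢y refl }))
                   (cong not (sym (arc-clique d c))))

  open Routes n arc

  offset<n : ∀ {c} → c < s → c + K < n
  offset<n c<s = +-monoˡ-< K c<s

  small<n : ∀ {c} → c < 3 → c + K < n
  small<n c<3 = offset<n (<-≤-trans c<3 3≤s)

  clique-cycle : Cyclic arc (0 + K) (1 + K) (2 + K)
  clique-cycle = record
    { p→q = arc-clique 0 1 ; q→r = arc-clique 1 2 ; r→p = arc-clique 2 0
    ; q↛p = arc-clique 1 0 ; r↛q = arc-clique 2 1 ; p↛r = arc-clique 0 2 }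

  In3-offset : ∀ {c} → c < 3 → In3 (0 + K) (1 + K) (2 + K) (c + K)
  In3-offset {0} _ = inj₁ refl
  In3-offset {1} _ = inj₂ (inj₁ refl)
  In3-offset {2} _ = inj₂ (inj₂ refl)
  In3-offset {suc (suc (suc _))} (s≤s (s≤s (s≤s ())))

  cycle-within : ∀ {c d} → c < 3 → d < 3 → Within 2 (c + K) (d + K)
  cycle-within c<3 d<3 = Cyclic-within clique-cycle (small<n {0} (s≤s z≤n)) (small<n {1} (s≤s (s≤s z≤n)))
                                       (small<n {2} ≤-refl) (In3-offset c<3) (In3-offset d<3)

  offset-cases : ∀ {c} → c < s → c < 3 ⊎ c ≡ 3
  offset-cases c<s = m≤n⇒m<n∨m≡n (≤-pred (≤-trans c<s s≤4))

  0→1 : Within 1 (0 + K) (1 + K)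
  0→1 = 1 , ≤-refl , hop (arc-clique 0 1) (small<n {1} (s≤s (s≤s z≤n))) stay

  1→3 : 3 < s → Within 1 (1 + K) (3 + K)
  1→3 3<s = 1 , ≤-refl , hop (arc-clique 1 3) (offset<n 3<s) stay

  3→0 : Within 1 (3 + K) (0 + K)
  3→0 = 1 , ≤-refl , hop (arc-clique 3 0) (small<n {0} (s≤s z≤n)) stay

  offset-hub : ∀ {c} → c < s → Within 2 (c + K) K × Within 2 K (c + K)
  offset-hub c<s with offset-cases c<s
  ... | inj₁ c<3  = cycle-within c<3 (s≤s z≤n) , cycle-within (s≤s z≤n) c<3
  ... | inj₂ refl = within-mono (n≤1+n 1) 3→0 , within-++ 0→1 (1→3 c<s)

  offset-within : ∀ {c d} → c < s → d < s → Within 3 (c + K) (d + K)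
  offset-within c<s d<s with offset-cases c<s | offset-cases d<s
  ... | inj₁ c<3  | inj₁ d<3  = within-mono (n≤1+n 2) (cycle-within c<3 d<3)
  ... | inj₁ c<3  | inj₂ refl = within-++ (cycle-within c<3 (s≤s (s≤s z≤n))) (1→3 d<s)
  ... | inj₂ refl | inj₁ d<3  = within-++ 3→0 (cycle-within (s≤s z≤n) d<3)
  ... | inj₂ refl | inj₂ refl = 0 , z≤n , stay

  clique-hub : ∀ {x} → K ≤ x → x < n → Within 2 x K × Within 2 K x
  clique-hub K≤x x<n with offset K≤x x<n
  ... | c , c<s , refl = offset-hub c<s

  clique-within : ∀ {x y} → K ≤ x → x < n → K ≤ y → y < n → Within 3 x y
  clique-within K≤x x<n K≤y y<n with offset K≤x x<n | offset K≤y y<n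
  ... | c , c<s , refl | d , d<s , refl = offset-within c<s d<s

  open ChainRoutes alternating (offset<n {0} (<-≤-trans (s≤s z≤n) 3≤s)) clique-hub clique-within

  upper-bound : ∀ {T} → 3 * suc k + 5 ≤ 2 * T →
                Σ[ O ∈ (Fin n → Fin n → Bool) ] (IsOrientation (ChainClique n (suc k)) O ×
                                                 (∀ u v → ∃[ l ] (l ≤ T × Walk O u v l)))
  upper-bound 3m+5≤2T = OnFin , orientation-from-ℕ orientation ,
                        λ u v → Within⇒Walk u v (route 3m+5≤2T (Fin.toℕ<n u) (Fin.toℕ<n v))

half-bounds : ∀ X → 2 * (X / 2) ≤ X × X ≤ suc (2 * (X / 2))
half-bounds X = subst (_≤ X) (*-comm (X / 2) 2) (m/n*n≤m X 2) , (begin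
  X                    ≡⟨ m≡m%n+[m/n]*n X 2 ⟩
  X % 2 + X / 2 * 2    ≤⟨ +-monoˡ-≤ (X / 2 * 2) (≤-pred (m%n<n X 2)) ⟩
  suc (X / 2 * 2)      ≡⟨ cong suc (*-comm (X / 2) 2) ⟩
  suc (2 * (X / 2))    ∎)
  where open ≤-Reasoning

chain-clique-diameter : ∀ k s → 3 ≤ s → s ≤ 4 →
                        OrientedDiam (ChainClique (s + suc k * 2) (suc k)) ((3 * suc k + 6) / 2)
chain-clique-diameter k s 3≤s s≤4 =
  oriented-diameter-criterion (λ O orient strong → far-pairs {T = T} O orient strong room (proj₁ halves))
                              (upper-bound (≤-pred (subst (_≤ suc (2 * T)) (+-suc (3 * suc k) 5) (proj₂ halves))))
  where
  open Construction k s 3≤s s≤4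
  T = (3 * suc k + 6) / 2
  halves = half-bounds (3 * suc k + 6)
  room : suc K < n
  room = +-monoˡ-< K (<-≤-trans (s≤s (s≤s z≤n)) 3≤s)

b-label : ∀ i → suc (i * 2) ≡ 2 * i + 1
b-label i = trans (cong suc (*-comm i 2)) (+-comm 1 (2 * i))

a′-label : ∀ i → suc i * 2 ≡ 2 * i + 2
a′-label i = trans (cong (2 +_) (*-comm i 2)) (+-comm 2 (2 * i))

InTri⇒InTriangle : ∀ {i x} → InTri i x → InTriangle i x
InTri⇒InTriangle {i} (inj₁ refl)        = subst (InTriangle i) (*-comm i 2) aᵢ
InTri⇒InTriangle {i} (inj₂ (inj₁ refl)) = subst (InTriangle i) (b-label i) bᵢ
InTri⇒InTriangle {i} (inj₂ (inj₂ refl)) = subst (InTriangle i) (a′-label i) aᵢ₊₁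

InTriangle⇒InTri : ∀ {i x} → InTriangle i x → InTri i x
InTriangle⇒InTri {i} aᵢ   = inj₁ (*-comm i 2)
InTriangle⇒InTri {i} bᵢ   = inj₂ (inj₁ (b-label i))
InTriangle⇒InTri {i} aᵢ₊₁ = inj₂ (inj₂ (a′-label i))

last-triangle : ∀ {k x} → suc k * 2 ≤ x → x < 3 + suc k * 2 → InTriangle (suc k) x
last-triangle K≤x x<n with offset {s = 3} K≤x x<n
... | 0 , _ , refl = aᵢ
... | 1 , _ , refl = bᵢ
... | 2 , _ , refl = aᵢ₊₁
... | suc (suc (suc _)) , s≤s (s≤s (s≤s ())) , _

odd-adjacency : ∀ {k x y} → ChainAdj (suc (suc k)) x y → Adjacent (suc k) x y
odd-adjacency (i , i<m , tx , ty) with m≤n⇒m<n∨m≡n (≤-pred i<m)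
... | inj₁ i<k+1 = inj₁ (i , i<k+1 , InTri⇒InTriangle tx , InTri⇒InTriangle ty)
... | inj₂ refl  = inj₂ (InTriangle-lower (InTri⇒InTriangle tx) , InTriangle-lower (InTri⇒InTriangle ty))

odd-adjacency⁻¹ : ∀ {k x y} → x < 3 + suc k * 2 → y < 3 + suc k * 2 → Adjacent (suc k) x y →
                  ChainAdj (suc (suc k)) x y
odd-adjacency⁻¹ _ _ (inj₁ (i , i<k+1 , tx , ty)) =
  i , m<n⇒m<1+n i<k+1 , InTriangle⇒InTri tx , InTriangle⇒InTri ty
odd-adjacency⁻¹ {k} x<n y<n (inj₂ (K≤x , K≤y)) =
  suc k , ≤-refl , InTriangle⇒InTri (last-triangle K≤x x<n) , InTriangle⇒InTri (last-triangle K≤y y<n)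

even-adjacency : ∀ {k x y} → ChainAdj (suc k) x y ⊎ K4Adj (suc k) x y → Adjacent (suc k) x y
even-adjacency (inj₁ (i , i<m , tx , ty)) = inj₁ (i , i<m , InTri⇒InTriangle tx , InTri⇒InTriangle ty)
even-adjacency {k} {x} {y} (inj₂ (x≥ , y≥)) =
  inj₂ (subst (_≤ x) (*-comm 2 (suc k)) x≥ , subst (_≤ y) (*-comm 2 (suc k)) y≥)

even-adjacency⁻¹ : ∀ {k x y} → Adjacent (suc k) x y → ChainAdj (suc k) x y ⊎ K4Adj (suc k) x y
even-adjacency⁻¹ (inj₁ (i , i<m , tx , ty)) = inj₁ (i , i<m , InTriangle⇒InTri tx , InTriangle⇒InTri ty)
even-adjacency⁻¹ {k} {x} {y} (inj₂ (K≤x , K≤y)) =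
  inj₂ (subst (_≤ x) (*-comm (suc k) 2) K≤x , subst (_≤ y) (*-comm (suc k) 2) K≤y)

odd-parity : ∀ k → (3 + suc k * 2) % 2 ≡ 1
odd-parity k = [m+kn]%n≡m%n 3 (suc k) 2

even-parity : ∀ k → (4 + suc k * 2) % 2 ≡ 0
even-parity k = [m+kn]%n≡m%n 4 (suc k) 2

odd-G′ : ∀ k {T} → OrientedDiam (ChainClique (3 + suc k * 2) (suc k)) T → OrientedDiam (G′ (3 + suc k * 2)) T
odd-G′ k = OrientedDiam-cong from-chain to-chain
  where
  n = 3 + suc k * 2
  triangles : (n ∸ 1) / 2 ≡ suc (suc k)
  triangles = m*n/n≡m (suc (suc k)) 2
  to-chain : ∀ {u v} → G′ n u v → ChainClique n (suc k) u v
  to-chain {u} {v} (u≢v , adj) = u≢v , odd-adjacency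
    (subst (λ m → ChainAdj m x y) triangles (subst (λ r → G′Adj r n x y) (odd-parity k) adj))
    where x = toℕ u ; y = toℕ v
  from-chain : ∀ {u v} → ChainClique n (suc k) u v → G′ n u v
  from-chain {u} {v} (u≢v , adj) = u≢v , subst (λ r → G′Adj r n x y) (sym (odd-parity k))
    (subst (λ m → ChainAdj m x y) (sym triangles) (odd-adjacency⁻¹ (Fin.toℕ<n u) (Fin.toℕ<n v) adj))
    where x = toℕ u ; y = toℕ v

even-G′ : ∀ k {T} → OrientedDiam (ChainClique (4 + suc k * 2) (suc k)) T → OrientedDiam (G′ (4 + suc k * 2)) T
even-G′ k = OrientedDiam-cong from-chain to-chain
  where
  n = 4 + suc k * 2
  triangles : (n ∸ 4) / 2 ≡ suc k
  triangles = m*n/n≡m (suc k) 2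
  EvenAdj : ℕ → ℕ → ℕ → Set
  EvenAdj m x y = ChainAdj m x y ⊎ K4Adj m x y
  to-chain : ∀ {u v} → G′ n u v → ChainClique n (suc k) u v
  to-chain {u} {v} (u≢v , adj) = u≢v , even-adjacency
    (subst (λ m → EvenAdj m x y) triangles (subst (λ r → G′Adj r n x y) (even-parity k) adj))
    where x = toℕ u ; y = toℕ v
  from-chain : ∀ {u v} → ChainClique n (suc k) u v → G′ n u v
  from-chain {u} {v} (u≢v , adj) = u≢v , subst (λ r → G′Adj r n x y) (sym (even-parity k))
    (subst (λ m → EvenAdj m x y) (sym triangles) (even-adjacency⁻¹ adj))
    where x = toℕ u ; y = toℕ v

target-odd : ∀ n → n % 2 ≡ 1 → target n ≡ (3 * (n + 1)) / 4
target-odd n odd rewrite odd = refl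

target-even : ∀ n → n % 2 ≡ 0 → target n ≡ (3 * n) / 4
target-even n even rewrite even = refl

odd-target : ∀ k → target (3 + suc k * 2) ≡ (3 * suc k + 6) / 2
odd-target k = begin
  target (3 + suc k * 2)                 ≡⟨ target-odd (3 + suc k * 2) (odd-parity k) ⟩
  (3 * (3 + suc k * 2 + 1)) / 4          ≡⟨ cong (_/ 4) (numerator k) ⟩
  (2 * (3 * suc k + 6)) / (2 * 2)        ≡⟨ m*n/m*o≡n/o 2 (3 * suc k + 6) 2 ⟩
  (3 * suc k + 6) / 2                    ∎
  where
  open ≡-Reasoning
  numerator : ∀ k → 3 * (3 + suc k * 2 + 1) ≡ 2 * (3 * suc k + 6)
  numerator = solve-∀

even-target : ∀ k → target (4 + suc k * 2) ≡ (3 * suc k + 6) / 2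
even-target k = begin
  target (4 + suc k * 2)                 ≡⟨ target-even (4 + suc k * 2) (even-parity k) ⟩
  (3 * (4 + suc k * 2)) / 4              ≡⟨ cong (_/ 4) (numerator k) ⟩
  (2 * (3 * suc k + 6)) / (2 * 2)        ≡⟨ m*n/m*o≡n/o 2 (3 * suc k + 6) 2 ⟩
  (3 * suc k + 6) / 2                    ∎
  where
  open ≡-Reasoning
  numerator : ∀ k → 3 * (4 + suc k * 2) ≡ 2 * (3 * suc k + 6)
  numerator = solve-∀

n-shape : ∀ n → 5 ≤ n → (∃[ k ] n ≡ 3 + suc k * 2) ⊎ (∃[ k ] n ≡ 4 + suc k * 2)
n-shape 0 ()
n-shape 1 (s≤s ())
n-shape 2 (s≤s (s≤s ()))
n-shape 3 (s≤s (s≤s (s≤s ())))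
n-shape 4 (s≤s (s≤s (s≤s (s≤s ()))))
n-shape 5 _ = inj₁ (0 , refl)
n-shape 6 _ = inj₂ (0 , refl)
n-shape (suc (suc n@(suc (suc (suc (suc (suc _))))))) _ with n-shape n (s≤s (s≤s (s≤s (s≤s (s≤s z≤n)))))
... | inj₁ (k , refl) = inj₁ (suc k , refl)
... | inj₂ (k , refl) = inj₂ (suc k , refl)

proposition4 : (n : ℕ) → 5 ≤ n → OrientedDiam (G′ n) (target n)
proposition4 n 5≤n with n-shape n 5≤n
... | inj₁ (k , refl) = subst (OrientedDiam (G′ n)) (sym (odd-target k))
                              (odd-G′ k (chain-clique-diameter k 3 ≤-refl (n≤1+n 3)))
... | inj₂ (k , refl) = subst (OrientedDiam (G′ n)) (sym (even-target k))
                              (even-G′ k (chain-clique-diameter k 4 (n≤1+n 3) ≤-refl))
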